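{- For every integer $n>0$, let $b=\lfloor \log_2 n\rfloor$ and $c=n+1-2^{b}$. Then $a_3(n)=2^{2b}+3c^2$.
   Context: A P-position of the game of Nim with $k$ piles is a $k$-tuple $(p_1,\dots,p_k)$ of non-negative integers whose nim-sum $p_1\oplus\cdots\oplus p_k$ is $0$, where $\oplus$ denotes bitwise XOR. $a_k(n)$ denotes the number of P-positions with $k$ piles such that every pile has at most $n$ counters (i.e. $\max_i p_i\le n$). -}

module Defs where

open import Data.Nat using (ℕ; zero; suc; _+_; _*_; _≡ᵇ_)
open import Data.Nat.DivMod using (_/_; _%_)
open import Data.Bool using (Bool; true; false; if_then_else_)
open import Data.List using (List; upTo; length; filter; concatMap; map; _∷_; [])
open import Data.Nat.Properties using (_≟_)
open import Data.Product using (_×_; _,_)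
open import Relation.Nullary.Decidable using (does)

-- Bitwise XOR of natural numbers, by recursion on binary digits.
-- The fuel argument bounds the number of bits processed; fuel = m + n
-- always suffices since each step halves both arguments.
xorFuel : ℕ → ℕ → ℕ → ℕ
xorFuel zero    m n = 0
xorFuel (suc f) m n =
  (if (m % 2) ≡ᵇ (n % 2) then 0 else 1) + 2 * xorFuel f (m / 2) (n / 2)

_⊕_ : ℕ → ℕ → ℕ
m ⊕ n = xorFuel (m + n) m n

infixl 6 _⊕_

triples : ℕ → List (ℕ × ℕ × ℕ)
triples n = concatMap (λ a → concatMap (λ b → map (λ c → (a , b , c)) (upTo (suc n))) (upTo (suc n))) (upTo (suc n))

nimSum₃ : ℕ × ℕ × ℕ → ℕ
nimSum₃ (a , b , c) = a ⊕ b ⊕ c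

-- a₃(n): number of 3-pile Nim P-positions with every pile ≤ n
a₃ : ℕ → ℕ
a₃ n = length (filter (λ t → nimSum₃ t ≟ 0) (triples n))

-- (a, b, c) is a P-position iff c = a ⊕ b, so a₃(n) counts the pairs a, b < N := n + 1
-- with a ⊕ b < N.  Write N = 2^k + c with 0 < c ≤ 2^k and split each coordinate at 2^k:
-- setting the bit 2^k in one argument of ⊕ sets it in the result and setting it in both
-- clears it.  So the 2^{2k} pairs below 2^k and the c² pairs above it all count, and each
-- of the two mixed blocks contributes c², because x ↦ x ⊕ y permutes {0, …, 2^k - 1}, hence
-- exactly c values of x give x ⊕ y < c.  That permutation count is itself proved by
-- splitting at the top bit.
module Submission where

open import Defs
open import Data.Bool using (Bool; true; false; if_then_else_; _xor_)
open import Data.Bool.Properties using (xor-comm; xor-same)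
open import Data.List using (List; []; _∷_; _++_; map; filter; concatMap; length; upTo; applyUpTo)
open import Data.List.Properties using (map-++; map-∘; map-cong; map-upTo)
open import Data.Nat
open import Data.Nat.DivMod using (m/n<m; m/n≤m; [m+kn]%n≡m%n; m<n⇒m%n≡m; m<n⇒m/n≡0; m*n/n≡m; +-distrib-/-∣ʳ)
open import Data.Nat.Divisibility using (divides)
open import Data.Nat.ListAction using (sum)
open import Data.Nat.ListAction.Properties using (sum-++)
open import Data.Nat.Logarithm using (⌊log₂_⌋; ⌊log₂⌋-mono-≤; ⌊log₂⌊n/2⌋⌋≡⌊log₂n⌋∸1; ⌊log₂[2^n]⌋≡n)
open import Data.Nat.Properties
open import Data.Nat.Tactic.RingSolver using (solve-∀)
open import Data.Product using (∃; ∃₂; _×_; _,_; uncurry)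
open import Data.Sum using (_⊎_; inj₁; inj₂)
open import Function using (_∘_; mk⇔)
open import Relation.Binary.PropositionalEquality
open import Relation.Nullary.Decidable using (yes; no; does; dec-true; dec-false; does-⇔)
open import Relation.Unary using (Pred; Decidable)

bit : Bool → ℕ
bit false = 0
bit true  = 1

bit<2 : ∀ i → bit i < 2
bit<2 false = s≤s z≤n
bit<2 true  = s≤s (s≤s z≤n)

-- Nim-sum

m≤1+n⇒m/2≤n : ∀ m n → m ≤ suc n → m / 2 ≤ n
m≤1+n⇒m/2≤n zero    n _   = z≤n
m≤1+n⇒m/2≤n (suc m) n m≤ = ≤-pred (≤-trans (m/n<m (suc m) 2 (s≤s (s≤s z≤n))) m≤)

xorFuel-irrelevant : ∀ f g m n → m ≤ f → n ≤ f → m ≤ g → n ≤ g →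
  xorFuel f m n ≡ xorFuel g m n
xorFuel-irrelevant zero    zero    m    n    _   _   _   _   = refl
xorFuel-irrelevant zero    (suc g) zero zero _   _   _   _   =
  cong (2 *_) (xorFuel-irrelevant zero g 0 0 z≤n z≤n z≤n z≤n)
xorFuel-irrelevant (suc f) zero    zero zero _   _   _   _   =
  cong (2 *_) (xorFuel-irrelevant f zero 0 0 z≤n z≤n z≤n z≤n)
xorFuel-irrelevant (suc f) (suc g) m    n    m≤f n≤f m≤g n≤g =
  cong (λ x → (if m % 2 ≡ᵇ n % 2 then 0 else 1) + 2 * x)
    (xorFuel-irrelevant f g (m / 2) (n / 2) 
      (m≤1+n⇒m/2≤n m f m≤f) (m≤1+n⇒m/2≤n n f n≤f) (m≤1+n⇒m/2≤n m g m≤g) (m≤1+n⇒m/2≤n n g n≤g))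

⊕-unfold : ∀ m n → m ⊕ n ≡ (if m % 2 ≡ᵇ n % 2 then 0 else 1) + 2 * (m / 2 ⊕ n / 2)
⊕-unfold m n = begin
  xorFuel (m + n) m n
    ≡⟨ xorFuel-irrelevant (m + n) (suc (m + n)) m n m≤m+n′ n≤m+n′ (m≤n⇒m≤1+n m≤m+n′) (m≤n⇒m≤1+n n≤m+n′) ⟩
  (if m % 2 ≡ᵇ n % 2 then 0 else 1) + 2 * xorFuel (m + n) (m / 2) (n / 2)
    ≡⟨ cong (λ x → (if m % 2 ≡ᵇ n % 2 then 0 else 1) + 2 * x)
         (xorFuel-irrelevant (m + n) (m / 2 + n / 2) (m / 2) (n / 2)
           (≤-trans (m/n≤m m 2) m≤m+n′) (≤-trans (m/n≤m n 2) n≤m+n′) (m≤m+n _ _) (m≤n+m _ _)) ⟩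
  (if m % 2 ≡ᵇ n % 2 then 0 else 1) + 2 * (m / 2 ⊕ n / 2) ∎
  where
  open ≡-Reasoning
  m≤m+n′ : m ≤ m + n
  m≤m+n′ = m≤m+n m n
  n≤m+n′ : n ≤ m + n
  n≤m+n′ = m≤n+m n m

bit+[a*2]%2 : ∀ i a → (bit i + a * 2) % 2 ≡ bit i
bit+[a*2]%2 i a = trans ([m+kn]%n≡m%n (bit i) a 2) (m<n⇒m%n≡m (bit<2 i))

bit+[a*2]/2 : ∀ i a → (bit i + a * 2) / 2 ≡ a
bit+[a*2]/2 i a = begin
  (bit i + a * 2) / 2    ≡⟨ +-distrib-/-∣ʳ (bit i) (divides a refl) ⟩
  bit i / 2 + a * 2 / 2  ≡⟨ cong₂ _+_ (m<n⇒m/n≡0 (bit<2 i)) (m*n/n≡m a 2) ⟩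
  a                      ∎
  where open ≡-Reasoning

⊕-digits : ∀ i j a b → (bit i + a * 2) ⊕ (bit j + b * 2) ≡ bit (i xor j) + (a ⊕ b) * 2
⊕-digits i j a b = begin
  m ⊕ n
    ≡⟨ ⊕-unfold m n ⟩
  (if m % 2 ≡ᵇ n % 2 then 0 else 1) + 2 * (m / 2 ⊕ n / 2)
    ≡⟨ cong₂ (λ r s → (if r ≡ᵇ s then 0 else 1) + 2 * (m / 2 ⊕ n / 2)) (bit+[a*2]%2 i a) (bit+[a*2]%2 j b) ⟩
  (if bit i ≡ᵇ bit j then 0 else 1) + 2 * (m / 2 ⊕ n / 2)
    ≡⟨ cong₂ (λ x y → (if bit i ≡ᵇ bit j then 0 else 1) + 2 * (x ⊕ y)) (bit+[a*2]/2 i a) (bit+[a*2]/2 j b) ⟩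
  (if bit i ≡ᵇ bit j then 0 else 1) + 2 * (a ⊕ b)
    ≡⟨ cong₂ _+_ (digit i j) (*-comm 2 (a ⊕ b)) ⟩
  bit (i xor j) + (a ⊕ b) * 2 ∎
  where
  open ≡-Reasoning
  m n : ℕ
  m = bit i + a * 2
  n = bit j + b * 2
  digit : ∀ i j → (if bit i ≡ᵇ bit j then 0 else 1) ≡ bit (i xor j)
  digit false false = refl
  digit false true  = refl
  digit true  false = refl
  digit true  true  = refl

bit-decomposition : ∀ m → ∃₂ λ i a → m ≡ bit i + a * 2
bit-decomposition zero = false , 0 , refl
bit-decomposition (suc m) with bit-decomposition m
... | false , a , refl = true , a , refl
... | true  , a , refl = false , suc a , refl

bit+[a*2]<2*H : ∀ i {a H} → a < H → bit i + a * 2 < 2 * H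
bit+[a*2]<2*H i {a} {H} a<H = begin-strict
  bit i + a * 2 <⟨ +-monoˡ-< (a * 2) (bit<2 i) ⟩
  suc a * 2     ≤⟨ *-monoˡ-≤ 2 a<H ⟩
  H * 2         ≡⟨ *-comm H 2 ⟩
  2 * H         ∎
  where open ≤-Reasoning

bit-split : ∀ k m → m < 2 ^ suc k → ∃₂ λ i a → m ≡ bit i + a * 2 × a < 2 ^ k
bit-split k m m< with bit-decomposition m
... | i , a , refl = i , a , refl , *-cancelʳ-< 2 a (2 ^ k) (begin-strict
  a * 2         ≤⟨ m≤n+m (a * 2) (bit i) ⟩
  bit i + a * 2 <⟨ m< ⟩
  2 * 2 ^ k     ≡⟨ *-comm 2 (2 ^ k) ⟩
  2 ^ k * 2     ∎)
  where open ≤-Reasoning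

bounded-binary-induction : ∀ {ℓ} (P : ℕ → ℕ → ℕ → Set ℓ) → P 0 0 0 →
  (∀ k i j a b → P k a b → P (suc k) (bit i + a * 2) (bit j + b * 2)) →
  ∀ k a b → a < 2 ^ k → b < 2 ^ k → P k a b
bounded-binary-induction P base step zero    _ _ (s≤s z≤n) (s≤s z≤n) = base
bounded-binary-induction P base step (suc k) a b a< b<
  with bit-split k a a< | bit-split k b b<
... | i , a′ , refl , a′< | j , b′ , refl , b′< =
  step k i j a′ b′ (bounded-binary-induction P base step k a′ b′ a′< b′<)

n<2^n : ∀ n → n < 2 ^ n
n<2^n zero    = s≤s z≤n
n<2^n (suc n) = +-mono-≤ (m^n>0 2 n) (≤-trans (n<2^n n) (m≤m+n (2 ^ n) 0))

binary-induction : ∀ {ℓ} (P : ℕ → ℕ → Set ℓ) → P 0 0 →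
  (∀ i j a b → P a b → P (bit i + a * 2) (bit j + b * 2)) →
  ∀ a b → P a b
binary-induction P base step a b =
  bounded-binary-induction (λ _ → P) base (λ _ → step) (a + b) a b
    (≤-<-trans (m≤m+n a b) (n<2^n (a + b))) (≤-<-trans (m≤n+m b a) (n<2^n (a + b)))

⊕-comm : ∀ a b → a ⊕ b ≡ b ⊕ a
⊕-comm = binary-induction (λ a b → a ⊕ b ≡ b ⊕ a) refl λ i j a b ih → begin
  (bit i + a * 2) ⊕ (bit j + b * 2) ≡⟨ ⊕-digits i j a b ⟩
  bit (i xor j) + (a ⊕ b) * 2       ≡⟨ cong₂ (λ d x → bit d + x * 2) (xor-comm i j) ih ⟩
  bit (j xor i) + (b ⊕ a) * 2       ≡⟨ ⊕-digits j i b a ⟨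
  (bit j + b * 2) ⊕ (bit i + a * 2) ∎
  where open ≡-Reasoning

-- The second argument is a dummy: this is an induction on the first one alone.
⊕-self : ∀ a → a ⊕ a ≡ 0
⊕-self a = binary-induction (λ a _ → a ⊕ a ≡ 0) refl step a 0
  where
  step : ∀ i j a b → a ⊕ a ≡ 0 → (bit i + a * 2) ⊕ (bit i + a * 2) ≡ 0
  step i _ a _ ih = begin
    (bit i + a * 2) ⊕ (bit i + a * 2) ≡⟨ ⊕-digits i i a a ⟩
    bit (i xor i) + (a ⊕ a) * 2       ≡⟨ cong₂ (λ d x → bit d + x * 2) (xor-same i) ih ⟩
    0                                 ∎
    where open ≡-Reasoning

⊕≡0⇒≡ : ∀ a b → a ⊕ b ≡ 0 → a ≡ b
⊕≡0⇒≡ = binary-induction (λ a b → a ⊕ b ≡ 0 → a ≡ b) (λ _ → refl) λ i j a b ih e →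
  digits-≡ ih i j (trans (sym (⊕-digits i j a b)) e)
  where
  digits-≡ : ∀ {a b} → (a ⊕ b ≡ 0 → a ≡ b) →
             ∀ i j → bit (i xor j) + (a ⊕ b) * 2 ≡ 0 → bit i + a * 2 ≡ bit j + b * 2
  digits-≡ {a} {b} ih false false e = cong (λ x → x * 2) (ih (m*n≡0⇒m≡0 (a ⊕ b) 2 e))
  digits-≡ {a} {b} ih true  true  e = cong (λ x → 1 + x * 2) (ih (m*n≡0⇒m≡0 (a ⊕ b) 2 e))
  digits-≡         ih false true  ()
  digits-≡         ih true  false ()

⊕-< : ∀ k a b → a < 2 ^ k → b < 2 ^ k → a ⊕ b < 2 ^ k
⊕-< = bounded-binary-induction (λ k a b → a ⊕ b < 2 ^ k) (s≤s z≤n) λ k i j a b ih →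
  subst (_< 2 ^ suc k) (sym (⊕-digits i j a b)) (bit+[a*2]<2*H (i xor j) ih)

2*H+[x+a*2]≡x+[H+a]*2 : ∀ H x a → 2 * H + (x + a * 2) ≡ x + (H + a) * 2
2*H+[x+a*2]≡x+[H+a]*2 = solve-∀

⊕-highˡ : ∀ k a b → a < 2 ^ k → b < 2 ^ k → (2 ^ k + a) ⊕ b ≡ 2 ^ k + (a ⊕ b)
⊕-highˡ = bounded-binary-induction (λ k a b → (2 ^ k + a) ⊕ b ≡ 2 ^ k + (a ⊕ b)) refl λ k i j a b ih →
  let H = 2 ^ k in begin
  (2 * H + (bit i + a * 2)) ⊕ (bit j + b * 2) ≡⟨ cong (_⊕ (bit j + b * 2)) (2*H+[x+a*2]≡x+[H+a]*2 H (bit i) a) ⟩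
  (bit i + (H + a) * 2) ⊕ (bit j + b * 2)     ≡⟨ ⊕-digits i j (H + a) b ⟩
  bit (i xor j) + ((H + a) ⊕ b) * 2           ≡⟨ cong (λ x → bit (i xor j) + x * 2) ih ⟩
  bit (i xor j) + (H + (a ⊕ b)) * 2           ≡⟨ 2*H+[x+a*2]≡x+[H+a]*2 H (bit (i xor j)) (a ⊕ b) ⟨
  2 * H + (bit (i xor j) + (a ⊕ b) * 2)       ≡⟨ cong (2 * H +_) (⊕-digits i j a b) ⟨
  2 * H + ((bit i + a * 2) ⊕ (bit j + b * 2)) ∎
  where open ≡-Reasoning

⊕-highʳ : ∀ k a b → a < 2 ^ k → b < 2 ^ k → a ⊕ (2 ^ k + b) ≡ 2 ^ k + (a ⊕ b)
⊕-highʳ k a b a< b< = begin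
  a ⊕ (2 ^ k + b) ≡⟨ ⊕-comm a (2 ^ k + b) ⟩
  (2 ^ k + b) ⊕ a ≡⟨ ⊕-highˡ k b a b< a< ⟩
  2 ^ k + (b ⊕ a) ≡⟨ cong (2 ^ k +_) (⊕-comm b a) ⟩
  2 ^ k + (a ⊕ b) ∎
  where open ≡-Reasoning

⊕-high-cancel : ∀ k a b → a < 2 ^ k → b < 2 ^ k → (2 ^ k + a) ⊕ (2 ^ k + b) ≡ a ⊕ b
⊕-high-cancel = bounded-binary-induction (λ k a b → (2 ^ k + a) ⊕ (2 ^ k + b) ≡ a ⊕ b) refl λ k i j a b ih →
  let H = 2 ^ k in begin
  (2 * H + (bit i + a * 2)) ⊕ (2 * H + (bit j + b * 2))
    ≡⟨ cong₂ _⊕_ (2*H+[x+a*2]≡x+[H+a]*2 H (bit i) a) (2*H+[x+a*2]≡x+[H+a]*2 H (bit j) b) ⟩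
  (bit i + (H + a) * 2) ⊕ (bit j + (H + b) * 2) ≡⟨ ⊕-digits i j (H + a) (H + b) ⟩
  bit (i xor j) + ((H + a) ⊕ (H + b)) * 2       ≡⟨ cong (λ x → bit (i xor j) + x * 2) ih ⟩
  bit (i xor j) + (a ⊕ b) * 2                   ≡⟨ ⊕-digits i j a b ⟨
  (bit i + a * 2) ⊕ (bit j + b * 2)             ∎
  where open ≡-Reasoning

-- Finite sums

∑< : ℕ → (ℕ → ℕ) → ℕ
∑< N f = sum (applyUpTo f N)

syntax ∑< N (λ i → e) = ∑[ i < N ] e

∑-cong : ∀ N {f g} → (∀ i → i < N → f i ≡ g i) → ∑< N f ≡ ∑< N g
∑-cong zero    f≗g = refl
∑-cong (suc N) f≗g = cong₂ _+_ (f≗g 0 (s≤s z≤n)) (∑-cong N (λ i i<N → f≗g (suc i) (s≤s i<N)))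

∑-const : ∀ N x → ∑[ _ < N ] x ≡ N * x
∑-const zero    x = refl
∑-const (suc N) x = cong (x +_) (∑-const N x)

∑-+ : ∀ M N f → ∑< (M + N) f ≡ ∑< M f + ∑[ i < N ] f (M + i)
∑-+ zero    N f = refl
∑-+ (suc M) N f = trans (cong (f 0 +_) (∑-+ M N (f ∘ suc))) (sym (+-assoc (f 0) _ _))

∑-double : ∀ H f → ∑< (2 * H) f ≡ ∑< H f + ∑[ i < H ] f (H + i)
∑-double H f rewrite +-identityʳ H = ∑-+ H H f

∑-distrib-+ : ∀ N f g → ∑[ i < N ] (f i + g i) ≡ ∑< N f + ∑< N g
∑-distrib-+ zero    f g = refl
∑-distrib-+ (suc N) f g =
  trans (cong (f 0 + g 0 +_) (∑-distrib-+ N (f ∘ suc) (g ∘ suc)))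
        (+-comm-middle (f 0) (g 0) (∑< N (f ∘ suc)) (∑< N (g ∘ suc)))
  where
  +-comm-middle : ∀ a b c d → a + b + (c + d) ≡ a + c + (b + d)
  +-comm-middle = solve-∀

∑-swap : ∀ M N (f : ℕ → ℕ → ℕ) → ∑[ i < M ] ∑[ j < N ] f i j ≡ ∑[ j < N ] ∑[ i < M ] f i j
∑-swap zero    N f = sym (trans (∑-const N 0) (*-zeroʳ N))
∑-swap (suc M) N f =
  trans (cong (∑< N (f 0) +_) (∑-swap M N (f ∘ suc)))
        (sym (∑-distrib-+ N (f 0) (λ j → ∑[ i < M ] f (suc i) j)))

∑-delta : ∀ N y → ∑[ c < N ] bit (y ≡ᵇ c) ≡ bit (y <ᵇ N)
∑-delta zero    y       = refl
∑-delta (suc N) zero    = cong suc (trans (∑-const N 0) (*-zeroʳ N))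
∑-delta (suc N) (suc y) = ∑-delta N y

count-all : ∀ N {p : ℕ → Bool} → (∀ i → i < N → p i ≡ true) → ∑[ i < N ] bit (p i) ≡ N
count-all N {p} p≗true = begin
  ∑[ i < N ] bit (p i) ≡⟨ ∑-cong N (λ i i<N → cong bit (p≗true i i<N)) ⟩
  ∑[ _ < N ] 1         ≡⟨ ∑-const N 1 ⟩
  N * 1                ≡⟨ *-identityʳ N ⟩
  N                    ∎
  where open ≡-Reasoning

count-none : ∀ N {p : ℕ → Bool} → (∀ i → i < N → p i ≡ false) → ∑[ i < N ] bit (p i) ≡ 0
count-none N {p} p≗false = begin
  ∑[ i < N ] bit (p i) ≡⟨ ∑-cong N (λ i i<N → cong bit (p≗false i i<N)) ⟩
  ∑[ _ < N ] 0         ≡⟨ ∑-const N 0 ⟩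
  N * 0                ≡⟨ *-zeroʳ N ⟩
  0                    ∎
  where open ≡-Reasoning

-- Counting pairs with small nim-sum

<ᵇ-true : ∀ {x N} → x < N → (x <ᵇ N) ≡ true
<ᵇ-true {x} {N} = dec-true (x <? N)

<ᵇ-false : ∀ {x N} → N ≤ x → (x <ᵇ N) ≡ false
<ᵇ-false {x} {N} = dec-false (x <? N) ∘ ≤⇒≯

+-<ᵇ-+ : ∀ M x c → (M + x <ᵇ M + c) ≡ (x <ᵇ c)
+-<ᵇ-+ zero    x c = refl
+-<ᵇ-+ (suc M) x c = +-<ᵇ-+ M x c

<2*H-split : ∀ H {x} → x < 2 * H → x < H ⊎ ∃ λ x′ → x ≡ H + x′ × x′ < H
<2*H-split H {x} x< with x <? H
... | yes x<H = inj₁ x<H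
... | no  x≮H = inj₂ (x ∸ H , sym x≡ ,
  +-cancelˡ-< H (x ∸ H) H (subst₂ _<_ (sym x≡) (cong (H +_) (+-identityʳ H)) x<))
  where
  x≡ : H + (x ∸ H) ≡ x
  x≡ = m+[n∸m]≡n (≮⇒≥ x≮H)

≤2*H-split : ∀ H {c} → c ≤ 2 * H → c ≤ H ⊎ ∃ λ d → c ≡ H + d × d ≤ H
≤2*H-split H {c} c≤ with c ≤? H
... | yes c≤H = inj₁ c≤H
... | no  c≰H = inj₂ (c ∸ H , sym c≡ ,
  +-cancelˡ-≤ H (c ∸ H) H (subst₂ _≤_ (sym c≡) (cong (H +_) (+-identityʳ H)) c≤))
  where
  c≡ : H + (c ∸ H) ≡ c
  c≡ = m+[n∸m]≡n (<⇒≤ (≰⇒> c≰H))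

-- Counting form of "g restricts to a permutation of {0, …, H - 1}".
Permutes : ℕ → (ℕ → ℕ) → Set
Permutes H g = ∀ c → c ≤ H → ∑[ a < H ] bit (g a <ᵇ c) ≡ c

permutes-halves : ∀ H g → Permutes H g → (∀ a → a < H → g a < H) →
  ∀ c → c ≤ 2 * H → ∑[ a < H ] bit (g a <ᵇ c) + ∑[ a < H ] bit (H + g a <ᵇ c) ≡ c
permutes-halves H g perm g< c c≤ with ≤2*H-split H c≤
... | inj₁ c≤H = trans
  (cong₂ _+_ (perm c c≤H) (count-none H (λ a _ → <ᵇ-false (≤-trans c≤H (m≤m+n H (g a))))))
  (+-identityʳ c)
... | inj₂ (d , refl , d≤H) = cong₂ _+_
  (count-all H (λ a a<H → <ᵇ-true (<-≤-trans (g< a a<H) (m≤m+n H d))))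
  (trans (∑-cong H (λ a _ → cong bit (+-<ᵇ-+ H (g a) d))) (perm d d≤H))

⊕-permutes : ∀ k x → x < 2 ^ k → Permutes (2 ^ k) (_⊕ x)
⊕-permutes zero    _ (s≤s z≤n) zero          _         = refl
⊕-permutes zero    _ (s≤s z≤n) (suc zero)    _         = refl
⊕-permutes zero    _ (s≤s z≤n) (suc (suc _)) (s≤s ())
⊕-permutes (suc k) x x< c c≤ with <2*H-split (2 ^ k) x<
... | inj₁ x<H = begin
  ∑[ a < 2 * H ] bit (a ⊕ x <ᵇ c)
    ≡⟨ ∑-double H _ ⟩
  ∑[ a < H ] bit (a ⊕ x <ᵇ c) + ∑[ a < H ] bit ((H + a) ⊕ x <ᵇ c)
    ≡⟨ cong (∑[ a < H ] bit (a ⊕ x <ᵇ c) +_)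
         (∑-cong H (λ a a<H → cong (λ v → bit (v <ᵇ c)) (⊕-highˡ k a x a<H x<H))) ⟩
  ∑[ a < H ] bit (a ⊕ x <ᵇ c) + ∑[ a < H ] bit (H + (a ⊕ x) <ᵇ c)
    ≡⟨ permutes-halves H (_⊕ x) (⊕-permutes k x x<H) (λ a a<H → ⊕-< k a x a<H x<H) c c≤ ⟩
  c ∎
  where
  open ≡-Reasoning
  H : ℕ
  H = 2 ^ k
... | inj₂ (x′ , refl , x′<H) = begin
  ∑[ a < 2 * H ] bit (a ⊕ (H + x′) <ᵇ c)
    ≡⟨ ∑-double H _ ⟩
  ∑[ a < H ] bit (a ⊕ (H + x′) <ᵇ c) + ∑[ a < H ] bit ((H + a) ⊕ (H + x′) <ᵇ c)
    ≡⟨ cong₂ _+_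
         (∑-cong H (λ a a<H → cong (λ v → bit (v <ᵇ c)) (⊕-highʳ k a x′ a<H x′<H)))
         (∑-cong H (λ a a<H → cong (λ v → bit (v <ᵇ c)) (⊕-high-cancel k a x′ a<H x′<H))) ⟩
  ∑[ a < H ] bit (H + (a ⊕ x′) <ᵇ c) + ∑[ a < H ] bit (a ⊕ x′ <ᵇ c)
    ≡⟨ +-comm (∑[ a < H ] bit (H + (a ⊕ x′) <ᵇ c)) _ ⟩
  ∑[ a < H ] bit (a ⊕ x′ <ᵇ c) + ∑[ a < H ] bit (H + (a ⊕ x′) <ᵇ c)
    ≡⟨ permutes-halves H (_⊕ x′) (⊕-permutes k x′ x′<H) (λ a a<H → ⊕-< k a x′ a<H x′<H) c c≤ ⟩
  c ∎
  where
  open ≡-Reasoning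
  H : ℕ
  H = 2 ^ k

xorPairs : ℕ → ℕ
xorPairs N = ∑[ a < N ] ∑[ b < N ] bit (a ⊕ b <ᵇ N)

xorPairs-row-low : ∀ k {a} c → a < 2 ^ k → c ≤ 2 ^ k →
  ∑[ b < 2 ^ k + c ] bit (a ⊕ b <ᵇ 2 ^ k + c) ≡ 2 ^ k + ∑[ b < c ] bit (a ⊕ b <ᵇ c)
xorPairs-row-low k {a} c a<M c≤M = begin
  ∑[ b < M + c ] bit (a ⊕ b <ᵇ M + c)
    ≡⟨ ∑-+ M c _ ⟩
  ∑[ b < M ] bit (a ⊕ b <ᵇ M + c) + ∑[ b < c ] bit (a ⊕ (M + b) <ᵇ M + c)
    ≡⟨ cong₂ _+_
         (count-all M (λ b b<M → <ᵇ-true (<-≤-trans (⊕-< k a b a<M b<M) (m≤m+n M c))))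
         (∑-cong c (λ b b<c → cong bit (begin
           a ⊕ (M + b) <ᵇ M + c   ≡⟨ cong (_<ᵇ M + c) (⊕-highʳ k a b a<M (<-≤-trans b<c c≤M)) ⟩
           M + (a ⊕ b) <ᵇ M + c   ≡⟨ +-<ᵇ-+ M (a ⊕ b) c ⟩
           a ⊕ b <ᵇ c             ∎))) ⟩
  M + ∑[ b < c ] bit (a ⊕ b <ᵇ c) ∎
  where
  open ≡-Reasoning
  M : ℕ
  M = 2 ^ k

xorPairs-row-high : ∀ k {a} c → a < c → c ≤ 2 ^ k →
  ∑[ b < 2 ^ k + c ] bit ((2 ^ k + a) ⊕ b <ᵇ 2 ^ k + c) ≡ c + c
xorPairs-row-high k {a} c a<c c≤M = begin
  ∑[ b < M + c ] bit ((M + a) ⊕ b <ᵇ M + c)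
    ≡⟨ ∑-+ M c _ ⟩
  ∑[ b < M ] bit ((M + a) ⊕ b <ᵇ M + c) + ∑[ b < c ] bit ((M + a) ⊕ (M + b) <ᵇ M + c)
    ≡⟨ cong₂ _+_
         (trans (∑-cong M (λ b b<M → cong bit (begin
                   (M + a) ⊕ b <ᵇ M + c   ≡⟨ cong (_<ᵇ M + c) (⊕-highˡ k a b a<M b<M) ⟩
                   M + (a ⊕ b) <ᵇ M + c   ≡⟨ +-<ᵇ-+ M (a ⊕ b) c ⟩
                   a ⊕ b <ᵇ c             ≡⟨ cong (_<ᵇ c) (⊕-comm a b) ⟩
                   b ⊕ a <ᵇ c             ∎)))
                (⊕-permutes k a a<M c c≤M))
         (count-all c (λ b b<c → <ᵇ-true
           (subst (_< M + c) (sym (⊕-high-cancel k a b a<M (<-≤-trans b<c c≤M)))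
             (<-≤-trans (⊕-< k a b a<M (<-≤-trans b<c c≤M)) (m≤m+n M c))))) ⟩
  c + c ∎
  where
  open ≡-Reasoning
  M : ℕ
  M = 2 ^ k
  a<M : a < M
  a<M = <-≤-trans a<c c≤M

xorPairs-2^k+c : ∀ k c → c ≤ 2 ^ k → xorPairs (2 ^ k + c) ≡ 2 ^ k * 2 ^ k + 3 * (c * c)
xorPairs-2^k+c k c c≤M = begin
  ∑[ a < M + c ] ∑[ b < M + c ] bit (a ⊕ b <ᵇ M + c)
    ≡⟨ ∑-+ M c _ ⟩
  ∑[ a < M ] ∑[ b < M + c ] bit (a ⊕ b <ᵇ M + c) + ∑[ a < c ] ∑[ b < M + c ] bit ((M + a) ⊕ b <ᵇ M + c)
    ≡⟨ cong₂ _+_ (∑-cong M (λ a a<M → xorPairs-row-low k c a<M c≤M))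
                 (∑-cong c (λ a a<c → xorPairs-row-high k c a<c c≤M)) ⟩
  ∑[ a < M ] (M + ∑[ b < c ] bit (a ⊕ b <ᵇ c)) + ∑[ _ < c ] (c + c)
    ≡⟨ cong₂ _+_ (∑-distrib-+ M (λ _ → M) _) (∑-const c (c + c)) ⟩
  ∑[ _ < M ] M + ∑[ a < M ] ∑[ b < c ] bit (a ⊕ b <ᵇ c) + c * (c + c)
    ≡⟨ cong (λ s → s + c * (c + c)) (cong₂ _+_ (∑-const M M) (∑-swap M c _)) ⟩
  M * M + ∑[ b < c ] ∑[ a < M ] bit (a ⊕ b <ᵇ c) + c * (c + c)
    ≡⟨ cong (λ s → M * M + s + c * (c + c))
         (trans (∑-cong c (λ b b<c → ⊕-permutes k b (<-≤-trans b<c c≤M) c c≤M)) (∑-const c c)) ⟩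
  M * M + c * c + c * (c + c)
    ≡⟨ collect M c ⟩
  M * M + 3 * (c * c) ∎
  where
  open ≡-Reasoning
  M : ℕ
  M = 2 ^ k
  collect : ∀ M c → M * M + c * c + c * (c + c) ≡ M * M + 3 * (c * c)
  collect = solve-∀

module _ {a ℓ} {A : Set a} {P : Pred A ℓ} (P? : Decidable P) where

  length-filter : ∀ xs → length (filter P? xs) ≡ sum (map (bit ∘ does ∘ P?) xs)
  length-filter []       = refl
  length-filter (x ∷ xs) with does (P? x)
  ... | true  = cong suc (length-filter xs)
  ... | false = length-filter xs

sum-map-concatMap : ∀ {a b} {A : Set a} {B : Set b} (f : B → ℕ) (h : A → List B) xs →
  sum (map f (concatMap h xs)) ≡ sum (map (λ x → sum (map f (h x))) xs)
sum-map-concatMap f h []       = refl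
sum-map-concatMap f h (x ∷ xs) = begin
  sum (map f (h x ++ concatMap h xs))
    ≡⟨ cong sum (map-++ f (h x) (concatMap h xs)) ⟩
  sum (map f (h x) ++ map f (concatMap h xs))
    ≡⟨ sum-++ (map f (h x)) _ ⟩
  sum (map f (h x)) + sum (map f (concatMap h xs))
    ≡⟨ cong (sum (map f (h x)) +_) (sum-map-concatMap f h xs) ⟩
  sum (map f (h x)) + sum (map (λ x → sum (map f (h x))) xs) ∎
  where open ≡-Reasoning

sum-map-upTo : ∀ N {f g} → (∀ i → f i ≡ g i) → sum (map f (upTo N)) ≡ ∑< N g
sum-map-upTo N {g = g} f≗g = trans (cong sum (map-cong f≗g (upTo N))) (cong sum (map-upTo g N))

a₃≡∑-triples : ∀ n → let N = suc n in
  a₃ n ≡ ∑[ a < N ] ∑[ b < N ] ∑[ c < N ] bit (a ⊕ b ⊕ c ≡ᵇ 0)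
a₃≡∑-triples n = begin
  length (filter P? (concatMap plane (upTo N)))
    ≡⟨ length-filter P? (concatMap plane (upTo N)) ⟩
  sum (map φ (concatMap plane (upTo N)))
    ≡⟨ sum-map-concatMap φ plane (upTo N) ⟩
  sum (map (λ a → sum (map φ (plane a))) (upTo N))
    ≡⟨ sum-map-upTo N (λ a → trans (sum-map-concatMap φ (line a) (upTo N))
                              (sum-map-upTo N (λ b →
                                trans (cong sum (sym (map-∘ (upTo N)))) (sum-map-upTo N (λ _ → refl))))) ⟩
  ∑[ a < N ] ∑[ b < N ] ∑[ c < N ] bit (a ⊕ b ⊕ c ≡ᵇ 0) ∎
  where
  open ≡-Reasoning
  N : ℕ
  N = suc n
  P? : Decidable (λ t → nimSum₃ t ≡ 0)
  P? t = nimSum₃ t ≟ 0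
  φ : ℕ × ℕ × ℕ → ℕ
  φ = bit ∘ does ∘ P?
  line : ℕ → ℕ → List (ℕ × ℕ × ℕ)
  line a b = map (λ c → (a , b , c)) (upTo N)
  plane : ℕ → List (ℕ × ℕ × ℕ)
  plane a = concatMap (line a) (upTo N)

⊕≡ᵇ0 : ∀ y c → (y ⊕ c ≡ᵇ 0) ≡ (y ≡ᵇ c)
⊕≡ᵇ0 y c = does-⇔ (mk⇔ (⊕≡0⇒≡ y c) (λ { refl → ⊕-self y })) (y ⊕ c ≟ 0) (y ≟ c)

a₃≡xorPairs : ∀ n → a₃ n ≡ xorPairs (suc n)
a₃≡xorPairs n = trans (a₃≡∑-triples n)
  (∑-cong N (λ a _ → ∑-cong N (λ b _ →
    trans (∑-cong N (λ c _ → cong bit (⊕≡ᵇ0 (a ⊕ b) c))) (∑-delta N (a ⊕ b)))))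
  where
  N : ℕ
  N = suc n

-- Binary logarithm

⌊n/2⌋<H : ∀ {n} H → n < 2 * H → ⌊ n /2⌋ < H
⌊n/2⌋<H {n} H n< = *-cancelˡ-< 2 ⌊ n /2⌋ H (begin-strict
  2 * ⌊ n /2⌋           ≡⟨ cong (⌊ n /2⌋ +_) (+-identityʳ ⌊ n /2⌋) ⟩
  ⌊ n /2⌋ + ⌊ n /2⌋     ≤⟨ +-monoʳ-≤ ⌊ n /2⌋ (⌊n/2⌋≤⌈n/2⌉ n) ⟩
  ⌊ n /2⌋ + ⌈ n /2⌉     ≡⟨ ⌊n/2⌋+⌈n/2⌉≡n n ⟩
  n                     <⟨ n< ⟩
  2 * H                 ∎)
  where open ≤-Reasoning

n<2^[1+k]⇒⌊log₂n⌋≤k : ∀ k n → n < 2 ^ suc k → ⌊log₂ n ⌋ ≤ k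
n<2^[1+k]⇒⌊log₂n⌋≤k zero    zero          _ = z≤n
n<2^[1+k]⇒⌊log₂n⌋≤k zero    (suc zero)    _ = z≤n
n<2^[1+k]⇒⌊log₂n⌋≤k zero    (suc (suc _)) (s≤s (s≤s ()))
n<2^[1+k]⇒⌊log₂n⌋≤k (suc k) n n< = begin
  ⌊log₂ n ⌋                ≤⟨ m≤n+m∸n ⌊log₂ n ⌋ 1 ⟩
  1 + (⌊log₂ n ⌋ ∸ 1)      ≡⟨ cong suc (⌊log₂⌊n/2⌋⌋≡⌊log₂n⌋∸1 n) ⟨
  1 + ⌊log₂ ⌊ n /2⌋ ⌋      ≤⟨ s≤s (n<2^[1+k]⇒⌊log₂n⌋≤k k ⌊ n /2⌋ (⌊n/2⌋<H (2 ^ suc k) n<)) ⟩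
  suc k                    ∎
  where open ≤-Reasoning

2^k≤n⇒k≤⌊log₂n⌋ : ∀ k n → 2 ^ k ≤ n → k ≤ ⌊log₂ n ⌋
2^k≤n⇒k≤⌊log₂n⌋ k n 2^k≤n = subst (_≤ ⌊log₂ n ⌋) (⌊log₂[2^n]⌋≡n k) (⌊log₂⌋-mono-≤ 2^k≤n)

∃2^k≤1+n<2^[1+k] : ∀ n → ∃ λ k → 2 ^ k ≤ suc n × suc n < 2 ^ suc k
∃2^k≤1+n<2^[1+k] zero = 0 , s≤s z≤n , s≤s (s≤s z≤n)
∃2^k≤1+n<2^[1+k] (suc n) with ∃2^k≤1+n<2^[1+k] n
... | k , lo , hi with m≤n⇒m<n∨m≡n hi
... | inj₁ 2+n<2^[1+k] = k , m≤n⇒m≤1+n lo , 2+n<2^[1+k]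
... | inj₂ 2+n≡2^[1+k] = suc k , ≤-reflexive (sym 2+n≡2^[1+k]) ,
  subst (_< 2 * 2 ^ suc k) (sym 2+n≡2^[1+k]) (m<m+n (2 ^ suc k) (≤-trans (m^n>0 2 (suc k)) (m≤m+n _ 0)))

2^⌊log₂n⌋≤n<2^[1+⌊log₂n⌋] : ∀ n → .{{_ : NonZero n}} → 2 ^ ⌊log₂ n ⌋ ≤ n × n < 2 ^ suc ⌊log₂ n ⌋
2^⌊log₂n⌋≤n<2^[1+⌊log₂n⌋] (suc n) with ∃2^k≤1+n<2^[1+k] n
... | k , lo , hi with ≤-antisym (n<2^[1+k]⇒⌊log₂n⌋≤k k (suc n) hi) (2^k≤n⇒k≤⌊log₂n⌋ k (suc n) lo)
... | refl = lo , hi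

a₃-closed-form : ∀ k n → 2 ^ k ≤ n → n < 2 ^ suc k → a₃ n ≡ 2 ^ (2 * k) + 3 * ((n + 1 ∸ 2 ^ k) ^ 2)
a₃-closed-form k n M≤n n<2M = begin
  a₃ n                      ≡⟨ a₃≡xorPairs n ⟩
  xorPairs (1 + n)          ≡⟨ cong xorPairs (+-comm 1 n) ⟩
  xorPairs (n + 1)          ≡⟨ cong xorPairs (m+[n∸m]≡n M≤n+1) ⟨
  xorPairs (M + c)          ≡⟨ xorPairs-2^k+c k c c≤M ⟩
  M * M + 3 * (c * c)       ≡⟨ cong₂ (λ x y → x + 3 * (c * y)) (^-distribˡ-+-* 2 k k) (*-identityʳ c) ⟨
  2 ^ (k + k) + 3 * c ^ 2   ≡⟨ cong (λ j → 2 ^ (k + j) + 3 * c ^ 2) (+-identityʳ k) ⟨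
  2 ^ (2 * k) + 3 * c ^ 2   ∎
  where
  open ≡-Reasoning
  M c : ℕ
  M = 2 ^ k
  c = n + 1 ∸ M
  M≤n+1 : M ≤ n + 1
  M≤n+1 = ≤-trans M≤n (m≤m+n n 1)
  c≤M : c ≤ M
  c≤M = m≤n+o⇒m∸n≤o (n + 1) M (subst₂ _≤_ (+-comm 1 n) (cong (M +_) (+-identityʳ M)) n<2M)

theorem12 : (n : ℕ) → .{{_ : NonZero n}} →
    a₃ n ≡ 2 ^ (2 * ⌊log₂ n ⌋) + 3 * ((n + 1 ∸ 2 ^ ⌊log₂ n ⌋) ^ 2)
theorem12 n = uncurry (a₃-closed-form ⌊log₂ n ⌋ n) (2^⌊log₂n⌋≤n<2^[1+⌊log₂n⌋] n)
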